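{- For every closed well-typed expression $e$ (i.e. $FV(e)=\emptyset$) of the calculus described in the context, one has $$\sum_{a\in|\mathsf{ty}(e)|}[\![e]\!]_{\star,a}=\mathsf{ht}(\mathsf{ty}(e)).$$
   Context: Types: positive types $P,Q::=\mathsf{Bool}\mid P\otimes Q$; arrow types $N::=P\multimap T$; let-term types $T,U::=P\mid N\mid P\otimes T$. There is a fixed set of variables, each carrying a fixed type $\mathsf{ty}(v)$ which is a positive or an arrow type; $v$ is called positive or arrow accordingly; $x,y,z$ denote positive variables, $f,g,h$ arrow variables, $v,w$ arbitrary ones. The web of a type is the finite set given by $|\mathsf{Bool}|=\{\mathsf t,\mathsf f\}$, $|P\otimes T|=|P\multimap T|=|P|\times|T|$. Constants $M$ are stochastic matrices $M\in\mathbb R_{\ge0}^{|P|\times|Q|}$ for positive types $P,Q$ (every row sums to $1$), of type $P\multimap Q$; there are also $0$-ary constants $M$ of type $Q$, namely probability vectors in $\mathbb R_{\ge0}^{|Q|}$. Syntax: patterns $\vec v::=v\mid(\vec v,\vec v')$ (the two components having no variable in common); expressions $e::=v\mid M(\vec x)\mid f\,\vec x\mid (e,e')\mid \lambda\vec x.e\mid \mathtt{let}\ \vec v=e\ \mathtt{in}\ e'$, where $\vec x$ denotes a positive pattern (all variables positive). $\lambda\vec x.e$ and $\mathtt{let}\ \vec v=e'\ \mathtt{in}\ e$ bind in $e$ the variables of the pattern; $FV(e)$ is the set of free variables and $FV^a(e)$ its arrow elements. Typing rules: $v:\mathsf{ty}(v)$; if $f:P\multimap T$ and $\vec x:P$ then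 $f\vec x:T$; if $M:P\multimap Q$ and $\vec x:P$ then $M(\vec x):Q$; if $\vec x:P$ and $e:T$ then $\lambda\vec x.e:P\multimap T$; if $e:P$, $e':T$ and $FV^a(e)\cap FV^a(e')=\emptyset$ then $(e,e'):P\otimes T$; if $\vec v:T$, $e:T$, $e':U$, $FV^a(e)\cap FV^a(e')=\emptyset$ and every arrow variable of $\vec v$ belongs to $FV^a(e')$, then $\mathtt{let}\ \vec v=e\ \mathtt{in}\ e':U$. A well-typed expression has a unique type $\mathsf{ty}(e)$. Semantics: for a finite set of variables $V$, $|V|=\prod_{v\in V}|\mathsf{ty}(v)|$ (elements are functions $a$ with $a_v\in|\mathsf{ty}(v)|$); $\star$ is the unique element of $|\emptyset|$; $a|_{V'}$ is restriction; for disjoint $V,W$, $a\uplus b\in|V\cup W|$ is the union of $a\in|V|,b\in|W|$. Elements of $|FV(\vec v)|$ for a pattern $\vec v$ are identified with elements of $|\mathsf{ty}(\vec v)|$ via the nested tuple structure of the pattern. A well-typed $e$ denotes $[\![e]\!]\in\mathbb R_{\ge0}^{|FV(e)|\times|\mathsf{ty}(e)|}$ defined by: $[\![v]\!]_{a,b}=\delta_{a_v,b}$; $[\![(e',e'')]\!]_{a,(b',b'')}=[\![e']\!]_{a|_{FV(e')},b'}[\![e'']\!]_{a|_{FV(e'')},b''}$; $[\![\mathtt{let}\ \vec v=e'\ \mathtt{in}\ e'']\!]_{a,b}=\sum_{c\in|FV(\vec v)|}[\![e']\!]_{a|_{FV(e')},c}[\![e'']\!]_{(a\uplus c)|_{FV(e'')},b}$;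 $[\![\lambda\vec v.e']\!]_{a,(b',b'')}=[\![e']\!]_{(a\uplus b')|_{FV(e')},b''}$; $[\![M(\vec x)]\!]_{a,b}=M_{a,b}$ (with $a$ read as the tuple ordered as $\vec x$); $[\![f\vec x]\!]_{a,b}=\delta_{a',a'''}\delta_{a'',b}$ where $a_f=(a',a'')$ and $a|_{\vec x}=a'''$ ($\delta$ is the Kronecker delta). Dimension and height: $\mathsf{dim}(\mathsf{Bool})=2$, $\mathsf{dim}(P\otimes Q)=\mathsf{dim}(P)\mathsf{dim}(Q)$; $\mathsf{ht}(P)=1$ for positive $P$, $\mathsf{ht}(P\multimap T)=\mathsf{dim}(P)\cdot\mathsf{ht}(T)$, $\mathsf{ht}(P\otimes T)=\mathsf{ht}(T)$. -}

module Defs where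

open import Level using (Level)
open import Data.Nat using (ℕ; zero; suc) renaming (_*_ to _*ℕ_)
open import Data.Bool using (Bool; true; false; _∧_)
open import Data.Product using (Σ; ∃; _×_; _,_)
open import Data.Sum using (_⊎_)
open import Data.Empty using (⊥)
open import Data.Unit using (⊤)
open import Data.List using (List; []; _∷_; foldr; cartesianProduct)
open import Relation.Nullary using (¬_; yes; no)
open import Relation.Binary.PropositionalEquality using (_≡_; refl; subst)
open import Relation.Binary.Definitions using (DecidableEquality)
open import Algebra.Bundles using (CommutativeSemiring)

-- Types.  One syntax for all types: bool, _⊗_, _⊸_ ; the grammar of the
-- paper is recovered by the predicates IsPos / IsLet / IsVarTy below.

infixr 6 _⊗_
infixr 5 _⊸_

data Ty : Set where
  bool : Ty
  _⊗_  : Ty → Ty → Ty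
  _⊸_  : Ty → Ty → Ty

data IsPos : Ty → Set where
  bool : IsPos bool
  _⊗_  : ∀ {P Q} → IsPos P → IsPos Q → IsPos (P ⊗ Q)

data IsLet : Ty → Set where
  pos : ∀ {P} → IsPos P → IsLet P
  arr : ∀ {P T} → IsPos P → IsLet T → IsLet (P ⊸ T)
  ten : ∀ {P T} → IsPos P → IsLet T → IsLet (P ⊗ T)

data IsArrow : Ty → Set where
  arr : ∀ {P T} → IsPos P → IsLet T → IsArrow (P ⊸ T)

IsVarTy : Ty → Set
IsVarTy A = IsPos A ⊎ IsArrow A

IsArrowShape : Ty → Set
IsArrowShape bool    = ⊥
IsArrowShape (_ ⊗ _) = ⊥
IsArrowShape (_ ⊸ _) = ⊤

web : Ty → Set
web bool    = Bool
web (P ⊗ T) = web P × web T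
web (P ⊸ T) = web P × web T

enum : (T : Ty) → List (web T)
enum bool    = true ∷ false ∷ []
enum (P ⊗ T) = cartesianProduct (enum P) (enum T)
enum (P ⊸ T) = cartesianProduct (enum P) (enum T)

eqW : (T : Ty) → web T → web T → Bool
eqW bool true  true  = true
eqW bool false false = true
eqW bool _     _     = false
eqW (P ⊗ T) (a , b) (a' , b') = eqW P a a' ∧ eqW T b b'
eqW (P ⊸ T) (a , b) (a' , b') = eqW P a a' ∧ eqW T b b'

dim : Ty → ℕ
dim bool    = 2
dim (P ⊗ Q) = dim P *ℕ dim Q
dim (P ⊸ Q) = dim P *ℕ dim Q   -- not used (dim is only applied to positive types)

ht : Ty → ℕ
ht bool    = 1
ht (P ⊗ T) = ht T
ht (P ⊸ T) = dim P *ℕ ht T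

module Calculus {c ℓ : Level} (R : CommutativeSemiring c ℓ)
                (Var : Set) (_≟_ : DecidableEquality Var) (ty : Var → Ty) where

  open CommutativeSemiring R renaming (Carrier to K)

  Σw : (T : Ty) → (web T → K) → K
  Σw T f = foldr (λ a acc → f a + acc) 0# (enum T)

  fromℕ : ℕ → K
  fromℕ zero    = 0#
  fromℕ (suc n) = 1# + fromℕ n

  δ : (T : Ty) → web T → web T → K
  δ T a b with eqW T a b
  ... | true  = 1#
  ... | false = 0#

  Stochastic : (P Q : Ty) → (web P → web Q → K) → Set ℓ
  Stochastic P Q M = ∀ a → Σw Q (M a) ≈ 1#

  ProbVec : (Q : Ty) → (web Q → K) → Set ℓ
  ProbVec Q m = Σw Q m ≈ 1#

  data Pat : Set where
    pvar  : Var → Pat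
    ppair : Pat → Pat → Pat

  _∈ₚ_ : Var → Pat → Set
  w ∈ₚ pvar v    = w ≡ v
  w ∈ₚ ppair p q = w ∈ₚ p ⊎ w ∈ₚ q

  PosPat : Pat → Set
  PosPat p = ∀ w → w ∈ₚ p → IsPos (ty w)

  data _⦂ₚ_ : Pat → Ty → Set where
    pvar  : ∀ v → pvar v ⦂ₚ ty v
    ppair : ∀ {p q A B} → p ⦂ₚ A → q ⦂ₚ B →
            (∀ w → w ∈ₚ p → w ∈ₚ q → ⊥) → ppair p q ⦂ₚ (A ⊗ B)

  -- expressions (constants carry their matrix / vector)
  data Expr : Set c where
    var  : Var → Expr
    cst  : (P Q : Ty) → (web P → web Q → K) → Pat → Expr
    cst0 : (Q : Ty) → (web Q → K) → Expr
    app  : Var → Pat → Expr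
    pair : Expr → Expr → Expr
    lam  : Pat → Expr → Expr
    lett : Pat → Expr → Expr → Expr

  FV : Var → Expr → Set
  FV w (var v)        = w ≡ v
  FV w (cst _ _ _ p)  = w ∈ₚ p
  FV w (cst0 _ _)     = ⊥
  FV w (app f p)      = w ≡ f ⊎ w ∈ₚ p
  FV w (pair e e')    = FV w e ⊎ FV w e'
  FV w (lam p e)      = ¬ (w ∈ₚ p) × FV w e
  FV w (lett p e e')  = FV w e ⊎ (¬ (w ∈ₚ p) × FV w e')

  FVa : Var → Expr → Set
  FVa w e = IsArrowShape (ty w) × FV w e

  DisjointA : Expr → Expr → Set
  DisjointA e e' = ∀ w → FVa w e → FVa w e' → ⊥

  Closed : Expr → Set
  Closed e = ∀ w → ¬ FV w e

  data _⦂_ : Expr → Ty → Set (c Level.⊔ ℓ) where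
    var  : ∀ v → var v ⦂ ty v
    cst  : ∀ {P Q M p} → IsPos P → IsPos Q → Stochastic P Q M →
           p ⦂ₚ P → PosPat p → cst P Q M p ⦂ Q
    cst0 : ∀ {Q m} → IsPos Q → ProbVec Q m → cst0 Q m ⦂ Q
    app  : ∀ {f p P T} → ty f ≡ (P ⊸ T) → p ⦂ₚ P → PosPat p → app f p ⦂ T
    pair : ∀ {e e' P T} → e ⦂ P → IsPos P → e' ⦂ T → DisjointA e e' →
           pair e e' ⦂ (P ⊗ T)
    lam  : ∀ {p e P T} → p ⦂ₚ P → PosPat p → e ⦂ T → lam p e ⦂ (P ⊸ T)
    lett : ∀ {p e e' T U} → p ⦂ₚ T → e ⦂ T → e' ⦂ U → DisjointA e e' →
           (∀ w → w ∈ₚ p → IsArrowShape (ty w) → FVa w e') →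
           lett p e e' ⦂ U

  -- environments (total valuations; the denotation only reads the free variables)
  Env : Set
  Env = (v : Var) → web (ty v)

  upd1 : (v : Var) → web (ty v) → Env → Env
  upd1 v c ρ w with w ≟ v
  ... | yes refl = c
  ... | no  _    = ρ w

  upd : ∀ {p T} → p ⦂ₚ T → web T → Env → Env
  upd (pvar v)        c         ρ = upd1 v c ρ
  upd (ppair dp dq _) (c₁ , c₂) ρ = upd dq c₂ (upd dp c₁ ρ)

  readP : ∀ {p T} → p ⦂ₚ T → Env → web T
  readP (pvar v)        ρ = ρ v
  readP (ppair dp dq _) ρ = readP dp ρ , readP dq ρ

  ⟦_⟧ : ∀ {e T} → e ⦂ T → Env → web T → K
  ⟦ var v ⟧ ρ b = δ (ty v) (ρ v) b
  ⟦ cst {M = M} _ _ _ dp _ ⟧ ρ b = M (readP dp ρ) b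
  ⟦ cst0 {m = m} _ _ ⟧ ρ b = m b
  ⟦ app {f = f} {P = P} {T = T} eq dp _ ⟧ ρ b with subst web eq (ρ f)
  ... | (a' , a'') = δ P a' (readP dp ρ) * δ T a'' b
  ⟦ pair d _ d' _ ⟧ ρ (b , b') = ⟦ d ⟧ ρ b * ⟦ d' ⟧ ρ b'
  ⟦ lam dp _ d ⟧ ρ (b' , b'') = ⟦ d ⟧ (upd dp b' ρ) b''
  ⟦ lett {T = T} dp d d' _ _ ⟧ ρ b =
    Σw T (λ c' → ⟦ d ⟧ ρ c' * ⟦ d' ⟧ (upd dp c' ρ) b)

{-# OPTIONS --safe #-}
-- Interpret expressions in environments Φ mapping each variable to a vector over its web rather
-- than to a point; at point masses δ (ρ w) this is the given semantics. Say v : web T → K has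
-- mass m when: at bool it sums to m; at A ⊗ B its slices v (a , -) have masses μ a with Σ μ = m;
-- at A ⊸ B every row v (a , -) has mass m. Such a vector sums to ht T · m. By induction on typing,
-- if every free positive variable carries a vector of mass 1 and every free arrow variable f one
-- of mass ω f, the denotation has mass the product of the ω f: stochastic constants preserve
-- mass, pairing multiplies it, and a let is a mixture over the values of the bound expression.
-- For a let-bound arrow variable the point masses it ranges over have no mass; but arrow
-- variables are used affinely, so the denotation is linear in each of them and the mixture
-- collapses to a single instance at the whole vector of the bound expression. A closed
-- expression therefore denotes a vector of mass 1, which sums to ht T.
module Submission where

open import Defs
open import Level using (Level; _⊔_)
open import Function using (_∘_)
open import Data.Nat as ℕ using (zero; suc)
open import Data.Bool using (Bool; true; false; _∧_)
open import Data.Product using (_×_; _,_; proj₁; proj₂)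
open import Data.Sum using (inj₁; inj₂; [_,_])
open import Data.Empty using (⊥-elim)
open import Data.Unit using (tt)
open import Data.List using (List; []; _∷_; foldr; map; _++_; cartesianProduct; length)
open import Data.List.Properties using (length-++; length-map; foldr-map)
open import Relation.Nullary using (¬_; yes; no; Dec)
open import Relation.Nullary.Decidable using (_⊎-dec_)
open import Relation.Binary.PropositionalEquality as ≡ using (_≡_; _≢_; _≗_; refl)
open import Relation.Binary.Definitions using (DecidableEquality)
open import Algebra.Bundles using (CommutativeSemiring)

module ListSum {c ℓ} (R : CommutativeSemiring c ℓ) where

  open CommutativeSemiring R renaming (refl to ≈-refl)
  open import Algebra.Definitions.RawMonoid +-rawMonoid using () renaming (_×_ to _·_)
  open import Algebra.Properties.CommutativeSemigroup +-commutativeSemigroup using (interchange)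
  open import Algebra.Properties.CommutativeSemigroup *-commutativeSemigroup using (x∙yz≈y∙xz)
  open import Relation.Binary.Reasoning.Setoid setoid

  private variable
    a b : Level
    X : Set a
    Y : Set b

  ∑ : List X → (X → Carrier) → Carrier
  ∑ xs f = foldr (λ x acc → f x + acc) 0# xs

  ∑-cong : ∀ (xs : List X) {f g} → (∀ x → f x ≈ g x) → ∑ xs f ≈ ∑ xs g
  ∑-cong []       f≈g = ≈-refl
  ∑-cong (x ∷ xs) f≈g = +-cong (f≈g x) (∑-cong xs f≈g)

  ∑-++ : ∀ (xs ys : List X) f → ∑ (xs ++ ys) f ≈ ∑ xs f + ∑ ys f
  ∑-++ []       ys f = sym (+-identityˡ _)
  ∑-++ (x ∷ xs) ys f = trans (+-congˡ (∑-++ xs ys f)) (sym (+-assoc _ _ _))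

  ∑-0 : ∀ (xs : List X) → ∑ xs (λ _ → 0#) ≈ 0#
  ∑-0 []       = ≈-refl
  ∑-0 (x ∷ xs) = trans (+-identityˡ _) (∑-0 xs)

  ∑-distrib-+ : ∀ (xs : List X) f g → ∑ xs (λ x → f x + g x) ≈ ∑ xs f + ∑ xs g
  ∑-distrib-+ []       f g = sym (+-identityˡ 0#)
  ∑-distrib-+ (x ∷ xs) f g =
    trans (+-congˡ (∑-distrib-+ xs f g)) (interchange (f x) (g x) _ _)

  *-distribˡ-∑ : ∀ k (xs : List X) f → k * ∑ xs f ≈ ∑ xs (λ x → k * f x)
  *-distribˡ-∑ k []       f = zeroʳ k
  *-distribˡ-∑ k (x ∷ xs) f = trans (distribˡ k _ _) (+-congˡ (*-distribˡ-∑ k xs f))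

  *-distribʳ-∑ : ∀ k (xs : List X) f → ∑ xs f * k ≈ ∑ xs (λ x → f x * k)
  *-distribʳ-∑ k xs f =
    trans (*-comm _ k) (trans (*-distribˡ-∑ k xs f) (∑-cong xs (λ x → *-comm k (f x))))

  ∑-const : ∀ (xs : List X) k → ∑ xs (λ _ → k) ≈ (length xs · 1#) * k
  ∑-const []       k = sym (zeroˡ k)
  ∑-const (x ∷ xs) k = begin
    k + ∑ xs (λ _ → k)             ≈⟨ +-cong (sym (*-identityˡ k)) (∑-const xs k) ⟩
    1# * k + (length xs · 1#) * k  ≈⟨ sym (distribʳ k _ _) ⟩
    (1# + length xs · 1#) * k      ∎

  ∑-cartesianProduct : ∀ (xs : List X) (ys : List Y) (f : X × Y → Carrier) →
    ∑ (cartesianProduct xs ys) f ≈ ∑ xs (λ x → ∑ ys (λ y → f (x , y)))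
  ∑-cartesianProduct []       ys f = ≈-refl
  ∑-cartesianProduct (x ∷ xs) ys f = begin
    ∑ (map (x ,_) ys ++ cartesianProduct xs ys) f
      ≈⟨ ∑-++ (map (x ,_) ys) _ f ⟩
    ∑ (map (x ,_) ys) f + ∑ (cartesianProduct xs ys) f
      ≈⟨ +-cong (reflexive (foldr-map _ (x ,_) 0# ys)) (∑-cartesianProduct xs ys f) ⟩
    ∑ ys (λ y → f (x , y)) + ∑ xs (λ x → ∑ ys (λ y → f (x , y))) ∎

  ∑-comm : ∀ (xs : List X) (ys : List Y) (f : X → Y → Carrier) →
    ∑ xs (λ x → ∑ ys (λ y → f x y)) ≈ ∑ ys (λ y → ∑ xs (λ x → f x y))
  ∑-comm []       ys f = sym (∑-0 ys)
  ∑-comm (x ∷ xs) ys f =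
    trans (+-congˡ (∑-comm xs ys f)) (sym (∑-distrib-+ ys (f x) _))

  ∑-factorʳ : ∀ (xs : List X) (t g : X → Carrier) k →
    ∑ xs (λ x → t x * (g x * k)) ≈ ∑ xs (λ x → t x * g x) * k
  ∑-factorʳ xs t g k =
    trans (∑-cong xs (λ x → sym (*-assoc (t x) (g x) k))) (sym (*-distribʳ-∑ k xs _))

  ∑-factorˡ : ∀ (xs : List X) (t g : X → Carrier) k →
    ∑ xs (λ x → t x * (k * g x)) ≈ k * ∑ xs (λ x → t x * g x)
  ∑-factorˡ xs t g k =
    trans (∑-cong xs (λ x → x∙yz≈y∙xz (t x) k (g x))) (sym (*-distribˡ-∑ k xs _))

  ∑-cartesianProduct-* : ∀ (xs : List X) (ys : List Y) (f : X → Carrier) (g : Y → Carrier) →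
    ∑ (cartesianProduct xs ys) (λ (x , y) → f x * g y) ≈ ∑ xs f * ∑ ys g
  ∑-cartesianProduct-* xs ys f g = begin
    ∑ (cartesianProduct xs ys) (λ (x , y) → f x * g y)
      ≈⟨ ∑-cartesianProduct xs ys _ ⟩
    ∑ xs (λ x → ∑ ys (λ y → f x * g y))
      ≈⟨ ∑-cong xs (λ x → sym (*-distribˡ-∑ (f x) ys g)) ⟩
    ∑ xs (λ x → f x * ∑ ys g)
      ≈⟨ *-distribʳ-∑ (∑ ys g) xs f ⟨
    ∑ xs f * ∑ ys g ∎

  ∑-*-∑ : ∀ (xs : List X) (ys : List Y) (t : X → Carrier) (g : X → Y → Carrier) →
    ∑ xs (λ x → t x * ∑ ys (g x)) ≈ ∑ ys (λ y → ∑ xs (λ x → t x * g x y))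
  ∑-*-∑ xs ys t g = trans (∑-cong xs (λ x → *-distribˡ-∑ (t x) ys (g x))) (∑-comm xs ys _)

length-cartesianProduct : ∀ {a b} {X : Set a} {Y : Set b} (xs : List X) (ys : List Y) →
  length (cartesianProduct xs ys) ≡ length xs ℕ.* length ys
length-cartesianProduct []       ys = refl
length-cartesianProduct (x ∷ xs) ys = ≡.trans (length-++ (map (x ,_) ys))
  (≡.cong₂ ℕ._+_ (length-map (x ,_) ys) (length-cartesianProduct xs ys))

module Update {a} {A : Set a} (_≟_ : DecidableEquality A) where

  private variable
    b : Level
    F : A → Set b

  _[_≔_] : ((x : A) → F x) → (x : A) → F x → (y : A) → F y
  (φ [ x ≔ v ]) y with y ≟ x
  ... | yes refl = v
  ... | no  _    = φ y

  update-≡ : ∀ (φ : (x : A) → F x) x v → (φ [ x ≔ v ]) x ≡ v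
  update-≡ φ x v with x ≟ x
  ... | yes refl = refl
  ... | no  x≢x  = ⊥-elim (x≢x refl)

  update-≢ : ∀ (φ : (x : A) → F x) {x y} v → y ≢ x → (φ [ x ≔ v ]) y ≡ φ y
  update-≢ φ {x} {y} v y≢x with y ≟ x
  ... | yes refl = ⊥-elim (y≢x refl)
  ... | no  _    = refl

  update-cong : ∀ (φ ψ : (x : A) → F x) x v {y} → φ y ≡ ψ y → (φ [ x ≔ v ]) y ≡ (ψ [ x ≔ v ]) y
  update-cong φ ψ x v {y} φy≡ψy with y ≟ x
  ... | yes refl = refl
  ... | no  _    = φy≡ψy

module Mass {c ℓ} (R : CommutativeSemiring c ℓ)
            (Var : Set) (_≟_ : DecidableEquality Var) (ty : Var → Ty) where

  open Calculus R Var _≟_ ty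
  open CommutativeSemiring R renaming (Carrier to K; refl to ≈-refl)
  open ListSum R
  open Update _≟_
  open import Algebra.Definitions.RawMonoid +-rawMonoid using () renaming (_×_ to _·_)
  open import Algebra.Properties.Semiring.Mult semiring using (×1-homo-*)
  open import Algebra.Properties.CommutativeSemigroup *-commutativeSemigroup using (x∙yz≈y∙xz)
  open import Relation.Binary.Reasoning.Setoid setoid

  fromℕ≡·1# : ∀ n → fromℕ n ≡ n · 1#
  fromℕ≡·1# zero    = refl
  fromℕ≡·1# (suc n) = ≡.cong (1# +_) (fromℕ≡·1# n)

  fromℕ-homo-* : ∀ m n → fromℕ (m ℕ.* n) ≈ fromℕ m * fromℕ n
  fromℕ-homo-* m n rewrite fromℕ≡·1# (m ℕ.* n) | fromℕ≡·1# m | fromℕ≡·1# n = ×1-homo-* m n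

  fromℕ-1 : ∀ k → fromℕ 1 * k ≈ k
  fromℕ-1 k = trans (*-congʳ (+-identityʳ 1#)) (*-identityˡ k)

  length-enum : ∀ T → length (enum T) ≡ dim T
  length-enum bool    = refl
  length-enum (A ⊗ B) = ≡.trans (length-cartesianProduct (enum A) (enum B))
                                (≡.cong₂ ℕ._*_ (length-enum A) (length-enum B))
  length-enum (A ⊸ B) = ≡.trans (length-cartesianProduct (enum A) (enum B))
                                (≡.cong₂ ℕ._*_ (length-enum A) (length-enum B))

  Σw-const : ∀ T k → Σw T (λ _ → k) ≈ fromℕ (dim T) * k
  Σw-const T k rewrite ≡.sym (length-enum T) | fromℕ≡·1# (length (enum T)) = ∑-const (enum T) k

  𝟙 : Bool → K
  𝟙 true  = 1#
  𝟙 false = 0#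

  𝟙-∧ : ∀ x y → 𝟙 (x ∧ y) ≈ 𝟙 x * 𝟙 y
  𝟙-∧ true  y = sym (*-identityˡ _)
  𝟙-∧ false y = sym (zeroˡ _)

  δ≡𝟙 : ∀ T a b → δ T a b ≡ 𝟙 (eqW T a b)
  δ≡𝟙 T a b with eqW T a b
  ... | true  = refl
  ... | false = refl

  eqW-sym : ∀ T a b → eqW T a b ≡ eqW T b a
  eqW-sym bool    true      true      = refl
  eqW-sym bool    true      false     = refl
  eqW-sym bool    false     true      = refl
  eqW-sym bool    false     false     = refl
  eqW-sym (A ⊗ B) (a₁ , a₂) (b₁ , b₂) = ≡.cong₂ _∧_ (eqW-sym A a₁ b₁) (eqW-sym B a₂ b₂)
  eqW-sym (A ⊸ B) (a₁ , a₂) (b₁ , b₂) = ≡.cong₂ _∧_ (eqW-sym A a₁ b₁) (eqW-sym B a₂ b₂)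

  δ-⊗ : ∀ A B a₁ a₂ b₁ b₂ → δ (A ⊗ B) (a₁ , a₂) (b₁ , b₂) ≈ δ A a₁ b₁ * δ B a₂ b₂
  δ-⊗ A B a₁ a₂ b₁ b₂
    rewrite δ≡𝟙 (A ⊗ B) (a₁ , a₂) (b₁ , b₂) | δ≡𝟙 A a₁ b₁ | δ≡𝟙 B a₂ b₂ =
    𝟙-∧ (eqW A a₁ b₁) (eqW B a₂ b₂)

  δ-⊸ : ∀ A B a₁ a₂ b₁ b₂ → δ (A ⊸ B) (a₁ , a₂) (b₁ , b₂) ≈ δ A a₁ b₁ * δ B a₂ b₂
  δ-⊸ A B a₁ a₂ b₁ b₂
    rewrite δ≡𝟙 (A ⊸ B) (a₁ , a₂) (b₁ , b₂) | δ≡𝟙 A a₁ b₁ | δ≡𝟙 B a₂ b₂ =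
    𝟙-∧ (eqW A a₁ b₁) (eqW B a₂ b₂)

  Sifts : Ty → Set (c ⊔ ℓ)
  Sifts T = ∀ x (h : web T → K) → Σw T (λ a → 𝟙 (eqW T x a) * h a) ≈ h x

  -- Σw and eqW unfold identically at A ⊗ B and A ⊸ B, so this serves both.
  sifts-pair : ∀ A B → Sifts A → Sifts B → Sifts (A ⊗ B)
  sifts-pair A B sifts-A sifts-B (x₁ , x₂) h = begin
    Σw (A ⊗ B) (λ a → 𝟙 (eqW (A ⊗ B) (x₁ , x₂) a) * h a)
      ≈⟨ ∑-cartesianProduct (enum A) (enum B) _ ⟩
    Σw A (λ a₁ → Σw B (λ a₂ → 𝟙 (eqW A x₁ a₁ ∧ eqW B x₂ a₂) * h (a₁ , a₂)))
      ≈⟨ ∑-cong (enum A) (λ a₁ → ∑-cong (enum B) (λ a₂ →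
           trans (*-congʳ (𝟙-∧ (eqW A x₁ a₁) (eqW B x₂ a₂))) (*-assoc _ _ _))) ⟩
    Σw A (λ a₁ → Σw B (λ a₂ → 𝟙 (eqW A x₁ a₁) * (𝟙 (eqW B x₂ a₂) * h (a₁ , a₂))))
      ≈⟨ ∑-cong (enum A) (λ a₁ → sym (*-distribˡ-∑ _ (enum B) _)) ⟩
    Σw A (λ a₁ → 𝟙 (eqW A x₁ a₁) * Σw B (λ a₂ → 𝟙 (eqW B x₂ a₂) * h (a₁ , a₂)))
      ≈⟨ ∑-cong (enum A) (λ a₁ → *-congˡ (sifts-B x₂ _)) ⟩
    Σw A (λ a₁ → 𝟙 (eqW A x₁ a₁) * h (a₁ , x₂))
      ≈⟨ sifts-A x₁ _ ⟩
    h (x₁ , x₂) ∎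

  sifts : ∀ T → Sifts T
  sifts bool true  h = trans (+-cong (*-identityˡ _) (trans (+-identityʳ _) (zeroˡ _))) (+-identityʳ _)
  sifts bool false h = trans (+-cong (zeroˡ _) (trans (+-identityʳ _) (*-identityˡ _))) (+-identityˡ _)
  sifts (A ⊗ B)      = sifts-pair A B (sifts A) (sifts B)
  sifts (A ⊸ B)      = sifts-pair A B (sifts A) (sifts B)

  ∑-δ : ∀ T x (h : web T → K) → Σw T (λ a → δ T x a * h a) ≈ h x
  ∑-δ T x h = trans (∑-cong (enum T) (λ a → *-congʳ (reflexive (δ≡𝟙 T x a)))) (sifts T x h)

  ∑-δʳ : ∀ T x (h : web T → K) → Σw T (λ a → h a * δ T a x) ≈ h x
  ∑-δʳ T x h = trans (∑-cong (enum T) (λ a → trans (*-comm _ _) (*-congʳ (reflexive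
    (≡.trans (δ≡𝟙 T a x) (≡.cong 𝟙 (eqW-sym T a x))))))) (sifts T x h)

  data HasMass : (T : Ty) → K → (web T → K) → Set (c ⊔ ℓ) where
    mass-bool : ∀ {m v} → Σw bool v ≈ m → HasMass bool m v
    mass-⊗    : ∀ {A B m v} (μ : web A → K) → Σw A μ ≈ m →
                (∀ a → HasMass B (μ a) (λ b → v (a , b))) → HasMass (A ⊗ B) m v
    mass-⊸    : ∀ {A B m v} → (∀ a → HasMass B m (λ b → v (a , b))) → HasMass (A ⊸ B) m v

  HasMass-resp : ∀ {T m m′ v v′} → m ≈ m′ → (∀ b → v b ≈ v′ b) → HasMass T m v → HasMass T m′ v′
  HasMass-resp m≈ v≈ (mass-bool s) = mass-bool (trans (sym (∑-cong (enum bool) v≈)) (trans s m≈))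
  HasMass-resp m≈ v≈ (mass-⊗ μ s h) =
    mass-⊗ μ (trans s m≈) (λ a → HasMass-resp ≈-refl (λ b → v≈ (a , b)) (h a))
  HasMass-resp m≈ v≈ (mass-⊸ h) = mass-⊸ (λ a → HasMass-resp m≈ (λ b → v≈ (a , b)) (h a))

  HasMass-0 : ∀ T → HasMass T 0# (λ _ → 0#)
  HasMass-0 bool    = mass-bool (∑-0 (enum bool))
  HasMass-0 (A ⊗ B) = mass-⊗ (λ _ → 0#) (∑-0 (enum A)) (λ _ → HasMass-0 B)
  HasMass-0 (A ⊸ B) = mass-⊸ (λ _ → HasMass-0 B)

  HasMass-+ : ∀ {T m m′ v v′} → HasMass T m v → HasMass T m′ v′ →
              HasMass T (m + m′) (λ b → v b + v′ b)
  HasMass-+ {v = v} {v′} (mass-bool s) (mass-bool s′) =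
    mass-bool (trans (∑-distrib-+ (enum bool) v v′) (+-cong s s′))
  HasMass-+ {A ⊗ B} (mass-⊗ μ s h) (mass-⊗ μ′ s′ h′) =
    mass-⊗ (λ a → μ a + μ′ a) (trans (∑-distrib-+ (enum A) μ μ′) (+-cong s s′))
           (λ a → HasMass-+ (h a) (h′ a))
  HasMass-+ (mass-⊸ h) (mass-⊸ h′) = mass-⊸ (λ a → HasMass-+ (h a) (h′ a))

  HasMass-* : ∀ k {T m v} → HasMass T m v → HasMass T (k * m) (λ b → k * v b)
  HasMass-* k {v = v} (mass-bool s) =
    mass-bool (trans (sym (*-distribˡ-∑ k (enum bool) v)) (*-congˡ s))
  HasMass-* k {A ⊗ B} (mass-⊗ μ s h) =
    mass-⊗ (λ a → k * μ a) (trans (sym (*-distribˡ-∑ k (enum A) μ)) (*-congˡ s))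
           (λ a → HasMass-* k (h a))
  HasMass-* k (mass-⊸ h) = mass-⊸ (λ a → HasMass-* k (h a))

  HasMass-∑ : ∀ {T} {X : Set} (xs : List X) {m : X → K} {v : X → web T → K} →
              (∀ x → HasMass T (m x) (v x)) → HasMass T (∑ xs m) (λ b → ∑ xs (λ x → v x b))
  HasMass-∑ {T} []       h = HasMass-0 T
  HasMass-∑     (x ∷ xs) h = HasMass-+ (h x) (HasMass-∑ xs h)

  HasMass-mix : ∀ {T k} {X : Set} (xs : List X) (π : X → K) {v : X → web T → K} →
                (∀ x → HasMass T k (v x)) →
                HasMass T (∑ xs π * k) (λ b → ∑ xs (λ x → π x * v x b))
  HasMass-mix xs π h = HasMass-resp (sym (*-distribʳ-∑ _ xs π)) (λ _ → ≈-refl)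
                                    (HasMass-∑ xs (λ x → HasMass-* (π x) (h x)))

  ∑-HasMass : ∀ {T m v} → HasMass T m v → Σw T v ≈ fromℕ (ht T) * m
  ∑-HasMass {m = m} (mass-bool s) = trans s (sym (fromℕ-1 m))
  ∑-HasMass {A ⊗ B} {m} {v} (mass-⊗ μ s h) = begin
    Σw (A ⊗ B) v                         ≈⟨ ∑-cartesianProduct (enum A) (enum B) v ⟩
    Σw A (λ a → Σw B (λ b → v (a , b)))  ≈⟨ ∑-cong (enum A) (λ a → ∑-HasMass (h a)) ⟩
    Σw A (λ a → fromℕ (ht B) * μ a)      ≈⟨ sym (*-distribˡ-∑ _ (enum A) μ) ⟩
    fromℕ (ht B) * Σw A μ                ≈⟨ *-congˡ s ⟩
    fromℕ (ht B) * m                     ∎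
  ∑-HasMass {A ⊸ B} {m} {v} (mass-⊸ h) = begin
    Σw (A ⊸ B) v                         ≈⟨ ∑-cartesianProduct (enum A) (enum B) v ⟩
    Σw A (λ a → Σw B (λ b → v (a , b)))  ≈⟨ ∑-cong (enum A) (λ a → ∑-HasMass (h a)) ⟩
    Σw A (λ a → fromℕ (ht B) * m)        ≈⟨ Σw-const A _ ⟩
    fromℕ (dim A) * (fromℕ (ht B) * m)   ≈⟨ sym (*-assoc _ _ _) ⟩
    fromℕ (dim A) * fromℕ (ht B) * m     ≈⟨ *-congʳ (sym (fromℕ-homo-* (dim A) (ht B))) ⟩
    fromℕ (dim A ℕ.* ht B) * m           ∎

  ht-pos : ∀ {T} → IsPos T → ht T ≡ 1
  ht-pos bool     = refl
  ht-pos (_ ⊗ pB) = ht-pos pB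

  HasMass⇒∑ : ∀ {T m v} → IsPos T → HasMass T m v → Σw T v ≈ m
  HasMass⇒∑ {T} {m} pT h = trans (∑-HasMass h)
    (trans (reflexive (≡.cong (λ n → fromℕ n * m) (ht-pos pT))) (fromℕ-1 m))

  ∑⇒HasMass : ∀ {T m v} → IsPos T → Σw T v ≈ m → HasMass T m v
  ∑⇒HasMass bool s = mass-bool s
  ∑⇒HasMass {A ⊗ B} {v = v} (_ ⊗ pB) s =
    mass-⊗ (λ a → Σw B (λ b → v (a , b))) (trans (sym (∑-cartesianProduct (enum A) (enum B) v)) s)
           (λ a → ∑⇒HasMass pB ≈-refl)

  δ-HasMass : ∀ {T} → IsPos T → ∀ x → HasMass T 1# (δ T x)
  δ-HasMass {T} pT x =
    ∑⇒HasMass pT (trans (∑-cong (enum T) (λ a → sym (*-identityʳ _))) (∑-δ T x (λ _ → 1#)))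

  _∈?_ : ∀ w p → Dec (w ∈ₚ p)
  w ∈? pvar v    = w ≟ v
  w ∈? ppair p q = (w ∈? p) ⊎-dec (w ∈? q)

  module _ {b} {F : Var → Set b} where

    PatValue : Pat → Set b
    PatValue p = ∀ {w} → w ∈ₚ p → F w

    _[_≔ₚ_] : ((v : Var) → F v) → (p : Pat) → PatValue p → (v : Var) → F v
    φ [ pvar v    ≔ₚ val ] = φ [ v ≔ val refl ]
    φ [ ppair p q ≔ₚ val ] = (φ [ p ≔ₚ (λ i → val (inj₁ i)) ]) [ q ≔ₚ (λ i → val (inj₂ i)) ]

    assign-∉ : ∀ (φ : (v : Var) → F v) p (val : PatValue p) {w} → ¬ w ∈ₚ p → (φ [ p ≔ₚ val ]) w ≡ φ w
    assign-∉ φ (pvar v)    val w∉ = update-≢ φ _ w∉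
    assign-∉ φ (ppair p q) val w∉ =
      ≡.trans (assign-∉ _ q _ (w∉ ∘ inj₂)) (assign-∉ φ p _ (w∉ ∘ inj₁))

    assign-∈ : ∀ (φ : (v : Var) → F v) {p T} → p ⦂ₚ T → ∀ (val : PatValue p) {w} (i : w ∈ₚ p) →
               (φ [ p ≔ₚ val ]) w ≡ val i
    assign-∈ φ (pvar v)          val refl     = update-≡ φ v (val refl)
    assign-∈ φ (ppair dp dq _)   val (inj₂ i) = assign-∈ _ dq _ i
    assign-∈ φ (ppair dp dq dis) val {w} (inj₁ i) =
      ≡.trans (assign-∉ _ _ _ (dis w i)) (assign-∈ φ dp _ i)

    assign-agree : ∀ (φ ψ : (v : Var) → F v) {p T} → p ⦂ₚ T → ∀ (val : PatValue p) w →
                   (¬ w ∈ₚ p → φ w ≡ ψ w) → (φ [ p ≔ₚ val ]) w ≡ (ψ [ p ≔ₚ val ]) w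
    assign-agree φ ψ {p} dp val w φw≡ψw with w ∈? p
    ... | yes i  = ≡.trans (assign-∈ φ dp val i) (≡.sym (assign-∈ ψ dp val i))
    ... | no  w∉ = ≡.trans (assign-∉ φ p val w∉) (≡.trans (φw≡ψw w∉) (≡.sym (assign-∉ ψ p val w∉)))

    assign-comm : ∀ (φ : (v : Var) → F v) {p T} → p ⦂ₚ T → ∀ (val : PatValue p) {f} x →
                  ¬ f ∈ₚ p → ∀ w →
                  ((φ [ f ≔ x ]) [ p ≔ₚ val ]) w ≡ ((φ [ p ≔ₚ val ]) [ f ≔ x ]) w
    assign-comm φ {p} dp val {f} x f∉ w with w ∈? p
    ... | yes i  = ≡.trans (assign-∈ _ dp val i)
                     (≡.sym (≡.trans (update-≢ _ x (λ { refl → f∉ i })) (assign-∈ φ dp val i)))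
    ... | no  w∉ = ≡.trans (assign-∉ _ p val w∉) (update-cong φ _ f x (≡.sym (assign-∉ φ p val w∉)))

  component : ∀ {p T} → p ⦂ₚ T → web T → ∀ {w} → w ∈ₚ p → web (ty w)
  component (pvar v)        c         refl     = c
  component (ppair dp dq _) (c₁ , c₂) (inj₁ i) = component dp c₁ i
  component (ppair dp dq _) (c₁ , c₂) (inj₂ i) = component dq c₂ i

  VecEnv : Set c
  VecEnv = (v : Var) → web (ty v) → K

  _[_≔δ_] : ∀ {p T} → VecEnv → p ⦂ₚ T → web T → VecEnv
  Φ [ dp ≔δ c ] = Φ [ _ ≔ₚ (λ {w} i → δ (ty w) (component dp c i)) ]

  _[_≔1] : (Var → K) → Pat → Var → K
  ω [ p ≔1] = ω [ p ≔ₚ (λ _ → 1#) ]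

  ⟦_⟧ₚ : ∀ {p T} → p ⦂ₚ T → VecEnv → web T → K
  ⟦ pvar v        ⟧ₚ Φ a         = Φ v a
  ⟦ ppair dp dq _ ⟧ₚ Φ (a₁ , a₂) = ⟦ dp ⟧ₚ Φ a₁ * ⟦ dq ⟧ₚ Φ a₂

  curried : ∀ {A P T} → A ≡ P ⊸ T → (web A → K) → web P → web T → K
  curried refl φ a b = φ (a , b)

  ⟦_⟧ᵥ : ∀ {e T} → e ⦂ T → VecEnv → web T → K
  ⟦ var v                            ⟧ᵥ Φ b        = Φ v b
  ⟦ cst {P = P} {M = M} _ _ _ dp _   ⟧ᵥ Φ b        = Σw P (λ a → ⟦ dp ⟧ₚ Φ a * M a b)
  ⟦ cst0 {m = m} _ _                 ⟧ᵥ Φ b        = m b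
  ⟦ app {f = f} {P = P} f⦂ dp _      ⟧ᵥ Φ b        = Σw P (λ a → ⟦ dp ⟧ₚ Φ a * curried f⦂ (Φ f) a b)
  ⟦ pair d _ d′ _                    ⟧ᵥ Φ (b , b′) = ⟦ d ⟧ᵥ Φ b * ⟦ d′ ⟧ᵥ Φ b′
  ⟦ lam dp _ d                       ⟧ᵥ Φ (a , b)  = ⟦ d ⟧ᵥ (Φ [ dp ≔δ a ]) b
  ⟦ lett {T = T} dp d d′ _ _         ⟧ᵥ Φ b        = Σw T (λ c → ⟦ d ⟧ᵥ Φ c * ⟦ d′ ⟧ᵥ (Φ [ dp ≔δ c ]) b)

  -- Positive variables may be duplicated, so they must carry vectors of mass 1; only arrow
  -- variables, which are used affinely, carry an arbitrary weight.
  arrowWeight : Ty → K → K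
  arrowWeight bool    _ = 1#
  arrowWeight (_ ⊗ _) _ = 1#
  arrowWeight (_ ⊸ _) k = k

  weight : ∀ {e T} → e ⦂ T → (Var → K) → K
  weight (var v)                   ω = arrowWeight (ty v) (ω v)
  weight (cst _ _ _ _ _)           _ = 1#
  weight (cst0 _ _)                _ = 1#
  weight (app {f = f} _ _ _)       ω = ω f
  weight (pair d _ d′ _)           ω = weight d ω * weight d′ ω
  weight (lam _ _ d)               ω = weight d ω
  weight (lett {p = p} _ d d′ _ _) ω = weight d ω * weight d′ (ω [ p ≔1])

  pos-not-arrow : ∀ {T} → IsPos T → ¬ IsArrowShape T
  pos-not-arrow bool    ()
  pos-not-arrow (_ ⊗ _) ()

  ≡⊸⇒shape : ∀ {A P T} → A ≡ P ⊸ T → IsArrowShape A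
  ≡⊸⇒shape refl = tt

  ⟦⟧ₚ-cong : ∀ {p T} (dp : p ⦂ₚ T) {Φ Ψ : VecEnv} → (∀ w → w ∈ₚ p → Φ w ≡ Ψ w) →
             ∀ a → ⟦ dp ⟧ₚ Φ a ≈ ⟦ dp ⟧ₚ Ψ a
  ⟦⟧ₚ-cong (pvar v)        Φ≡Ψ a         = reflexive (≡.cong-app (Φ≡Ψ v refl) a)
  ⟦⟧ₚ-cong (ppair dp dq _) Φ≡Ψ (a₁ , a₂) =
    *-cong (⟦⟧ₚ-cong dp (λ w → Φ≡Ψ w ∘ inj₁) a₁) (⟦⟧ₚ-cong dq (λ w → Φ≡Ψ w ∘ inj₂) a₂)

  ⟦⟧ᵥ-cong : ∀ {e T} (d : e ⦂ T) {Φ Ψ : VecEnv} → (∀ w → FV w e → Φ w ≡ Ψ w) →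
             ∀ b → ⟦ d ⟧ᵥ Φ b ≈ ⟦ d ⟧ᵥ Ψ b
  ⟦⟧ᵥ-cong (var v) Φ≡Ψ b = reflexive (≡.cong-app (Φ≡Ψ v refl) b)
  ⟦⟧ᵥ-cong (cst {P = P} _ _ _ dp _) Φ≡Ψ b = ∑-cong (enum P) (λ a → *-congʳ (⟦⟧ₚ-cong dp Φ≡Ψ a))
  ⟦⟧ᵥ-cong (cst0 _ _) Φ≡Ψ b = ≈-refl
  ⟦⟧ᵥ-cong (app {f = f} {P = P} f⦂ dp _) Φ≡Ψ b = ∑-cong (enum P) (λ a →
    *-cong (⟦⟧ₚ-cong dp (λ w → Φ≡Ψ w ∘ inj₂) a)
           (reflexive (≡.cong (λ φ → curried f⦂ φ a b) (Φ≡Ψ f (inj₁ refl)))))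
  ⟦⟧ᵥ-cong (pair d _ d′ _) Φ≡Ψ (b , b′) =
    *-cong (⟦⟧ᵥ-cong d (λ w → Φ≡Ψ w ∘ inj₁) b) (⟦⟧ᵥ-cong d′ (λ w → Φ≡Ψ w ∘ inj₂) b′)
  ⟦⟧ᵥ-cong (lam dp _ d) Φ≡Ψ (a , b) =
    ⟦⟧ᵥ-cong d (λ w i → assign-agree _ _ dp _ w (λ w∉ → Φ≡Ψ w (w∉ , i))) b
  ⟦⟧ᵥ-cong (lett {T = T} dp d d′ _ _) Φ≡Ψ b = ∑-cong (enum T) (λ c →
    *-cong (⟦⟧ᵥ-cong d (λ w → Φ≡Ψ w ∘ inj₁) c)
           (⟦⟧ᵥ-cong d′ (λ w i → assign-agree _ _ dp _ w (λ w∉ → Φ≡Ψ w (inj₂ (w∉ , i)))) b))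

  arrowWeight-cong : ∀ T {k k′} → (IsArrowShape T → k ≡ k′) → arrowWeight T k ≡ arrowWeight T k′
  arrowWeight-cong bool    _ = refl
  arrowWeight-cong (_ ⊗ _) _ = refl
  arrowWeight-cong (_ ⊸ _) k≡k′ = k≡k′ tt

  weight-cong : ∀ {e T} (d : e ⦂ T) {ω ω′ : Var → K} → (∀ w → FVa w e → ω w ≡ ω′ w) →
                weight d ω ≡ weight d ω′
  weight-cong (var v) ω≡ω′ = arrowWeight-cong (ty v) (λ v↑ → ω≡ω′ v (v↑ , refl))
  weight-cong (cst _ _ _ _ _) ω≡ω′ = refl
  weight-cong (cst0 _ _) ω≡ω′ = refl
  weight-cong (app {f = f} f⦂ _ _) ω≡ω′ = ω≡ω′ f (≡⊸⇒shape f⦂ , inj₁ refl)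
  weight-cong (pair d _ d′ _) ω≡ω′ = ≡.cong₂ _*_
    (weight-cong d (λ w (w↑ , i) → ω≡ω′ w (w↑ , inj₁ i)))
    (weight-cong d′ (λ w (w↑ , i) → ω≡ω′ w (w↑ , inj₂ i)))
  weight-cong (lam _ pp d) ω≡ω′ =
    weight-cong d (λ w (w↑ , i) → ω≡ω′ w (w↑ , (λ w∈ → pos-not-arrow (pp w w∈) w↑) , i))
  weight-cong (lett dp d d′ _ _) ω≡ω′ = ≡.cong₂ _*_
    (weight-cong d (λ w (w↑ , i) → ω≡ω′ w (w↑ , inj₁ i)))
    (weight-cong d′ (λ w (w↑ , i) → assign-agree _ _ dp _ w (λ w∉ → ω≡ω′ w (w↑ , inj₂ (w∉ , i)))))

  ⟦⟧ᵥ-update-∉ : ∀ {e T} (d : e ⦂ T) {f} → ¬ FV f e → ∀ Φ x b → ⟦ d ⟧ᵥ (Φ [ f ≔ x ]) b ≈ ⟦ d ⟧ᵥ Φ b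
  ⟦⟧ᵥ-update-∉ d f∉ Φ x = ⟦⟧ᵥ-cong d (λ w i → update-≢ Φ x (λ { refl → f∉ i }))

  ⟦⟧ᵥ-assign-comm : ∀ {e T} (d : e ⦂ T) {p A} (dp : p ⦂ₚ A) c {f} → ¬ f ∈ₚ p → ∀ Φ x b →
    ⟦ d ⟧ᵥ ((Φ [ f ≔ x ]) [ dp ≔δ c ]) b ≈ ⟦ d ⟧ᵥ ((Φ [ dp ≔δ c ]) [ f ≔ x ]) b
  ⟦⟧ᵥ-assign-comm d dp c f∉ Φ x = ⟦⟧ᵥ-cong d (λ w _ → assign-comm Φ dp _ x f∉ w)

  Linear : ∀ A → ((web A → K) → K) → Set (c ⊔ ℓ)
  Linear A F = ∀ t → Σw A (λ c → t c * F (δ A c)) ≈ F t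

  linear-eval : ∀ A x → Linear A (λ φ → φ x)
  linear-eval A x t = ∑-δʳ A x t

  linear-resp : ∀ {A F G} → (∀ φ → F φ ≈ G φ) → Linear A F → Linear A G
  linear-resp {A} F≈G lin t =
    trans (∑-cong (enum A) (λ c → *-congˡ (sym (F≈G _)))) (trans (lin t) (F≈G t))

  linear-*ʳ : ∀ {A F} k → Linear A F → Linear A (λ φ → F φ * k)
  linear-*ʳ {A} k lin t = trans (∑-factorʳ (enum A) t _ k) (*-congʳ (lin t))

  linear-*ˡ : ∀ {A F} k → Linear A F → Linear A (λ φ → k * F φ)
  linear-*ˡ {A} k lin t = trans (∑-factorˡ (enum A) t _ k) (*-congˡ (lin t))

  linear-∑ : ∀ {A} {X : Set} (xs : List X) {F : X → (web A → K) → K} →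
             (∀ x → Linear A (F x)) → Linear A (λ φ → ∑ xs (λ x → F x φ))
  linear-∑ {A} xs lin t = trans (∑-*-∑ (enum A) xs t _) (∑-cong xs (λ x → lin x t))

  linear-curried : ∀ {A P T} (A≡ : A ≡ P ⊸ T) a b → Linear A (λ φ → curried A≡ φ a b)
  linear-curried {P = P} {T} refl a b = linear-eval (P ⊸ T) (a , b)

  ⟦⟧ᵥ-linear : ∀ {e T} (d : e ⦂ T) {f} → IsArrowShape (ty f) → FV f e →
               ∀ Φ b → Linear (ty f) (λ φ → ⟦ d ⟧ᵥ (Φ [ f ≔ φ ]) b)
  ⟦⟧ᵥ-linear (var f) f↑ refl Φ b =
    linear-resp (λ φ → reflexive (≡.cong-app (≡.sym (update-≡ Φ f φ)) b)) (linear-eval (ty f) b)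
  ⟦⟧ᵥ-linear (cst _ _ _ _ pp) f↑ i = ⊥-elim (pos-not-arrow (pp _ i) f↑)
  ⟦⟧ᵥ-linear (cst0 _ _) f↑ ()
  ⟦⟧ᵥ-linear (app f⦂ dp pp) f↑ (inj₂ i) = ⊥-elim (pos-not-arrow (pp _ i) f↑)
  ⟦⟧ᵥ-linear (app {P = P} f⦂ dp pp) {f} f↑ (inj₁ refl) Φ b =
    linear-resp app-at (linear-∑ (enum P) (λ a → linear-*ˡ _ (linear-curried f⦂ a b)))
    where
    app-at : ∀ φ → Σw P (λ a → ⟦ dp ⟧ₚ Φ a * curried f⦂ φ a b) ≈ ⟦ app f⦂ dp pp ⟧ᵥ (Φ [ f ≔ φ ]) b
    app-at φ = ∑-cong (enum P) (λ a → *-cong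
      (⟦⟧ₚ-cong dp (λ w i → ≡.sym (update-≢ Φ φ (λ { refl → pos-not-arrow (pp f i) f↑ }))) a)
      (reflexive (≡.cong (λ ψ → curried f⦂ ψ a b) (≡.sym (update-≡ Φ f φ)))))
  ⟦⟧ᵥ-linear (pair d _ d′ dis) {f} f↑ (inj₁ i) Φ (b , b′) =
    linear-resp (λ φ → *-congˡ (sym (⟦⟧ᵥ-update-∉ d′ f∉ Φ φ b′))) (linear-*ʳ _ (⟦⟧ᵥ-linear d f↑ i Φ b))
    where f∉ = λ j → dis f (f↑ , i) (f↑ , j)
  ⟦⟧ᵥ-linear (pair d _ d′ dis) {f} f↑ (inj₂ i) Φ (b , b′) =
    linear-resp (λ φ → *-congʳ (sym (⟦⟧ᵥ-update-∉ d f∉ Φ φ b))) (linear-*ˡ _ (⟦⟧ᵥ-linear d′ f↑ i Φ b′))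
    where f∉ = λ j → dis f (f↑ , j) (f↑ , i)
  ⟦⟧ᵥ-linear (lam dp _ d) f↑ (f∉ , i) Φ (a , b) =
    linear-resp (λ φ → sym (⟦⟧ᵥ-assign-comm d dp a f∉ Φ φ b)) (⟦⟧ᵥ-linear d f↑ i (Φ [ dp ≔δ a ]) b)
  ⟦⟧ᵥ-linear (lett {T = T} dp d d′ dis _) {f} f↑ (inj₁ i) Φ b =
    linear-∑ (enum T) (λ c →
      linear-resp (λ φ → *-congˡ (sym (body-irrelevant φ c))) (linear-*ʳ _ (⟦⟧ᵥ-linear d f↑ i Φ c)))
    where
    body-irrelevant : ∀ φ c → ⟦ d′ ⟧ᵥ ((Φ [ f ≔ φ ]) [ dp ≔δ c ]) b ≈ ⟦ d′ ⟧ᵥ (Φ [ dp ≔δ c ]) b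
    body-irrelevant φ c = ⟦⟧ᵥ-cong d′ (λ w j → assign-agree _ _ dp _ w (λ _ →
      update-≢ Φ φ (λ { refl → dis f (f↑ , i) (f↑ , j) }))) b
  ⟦⟧ᵥ-linear (lett {T = T} dp d d′ dis _) {f} f↑ (inj₂ (f∉ , i)) Φ b =
    linear-∑ (enum T) (λ c →
      linear-resp (λ φ → *-cong (sym (⟦⟧ᵥ-update-∉ d f∉e Φ φ c))
                                (sym (⟦⟧ᵥ-assign-comm d′ dp c f∉ Φ φ b)))
                  (linear-*ˡ _ (⟦⟧ᵥ-linear d′ f↑ i (Φ [ dp ≔δ c ]) b)))
    where f∉e = λ j → dis f (f↑ , j) (f↑ , i)

  arrowWeight-arrow : ∀ T {k} → IsArrowShape T → arrowWeight T k ≡ k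
  arrowWeight-arrow (_ ⊸ _) _ = refl

  weight-update-∉ : ∀ {e T} (d : e ⦂ T) {f} → ¬ FV f e → ∀ ω x y →
                    weight d (ω [ f ≔ x ]) ≡ weight d (ω [ f ≔ y ])
  weight-update-∉ d f∉ ω x y = weight-cong d (λ w (_ , i) →
    ≡.trans (update-≢ ω x (λ { refl → f∉ i })) (≡.sym (update-≢ ω y (λ { refl → f∉ i }))))

  weight-assign-comm : ∀ {e T} (d : e ⦂ T) {p A} (dp : p ⦂ₚ A) {f} → ¬ f ∈ₚ p → ∀ ω x →
    weight d ((ω [ f ≔ x ]) [ p ≔1]) ≡ weight d ((ω [ p ≔1]) [ f ≔ x ])
  weight-assign-comm d dp f∉ ω x = weight-cong d (λ w _ → assign-comm ω dp _ x f∉ w)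

  weight-linear : ∀ {e T} (d : e ⦂ T) {f} → IsArrowShape (ty f) → FV f e →
                  ∀ ω μ → weight d (ω [ f ≔ μ ]) ≈ μ * weight d (ω [ f ≔ 1# ])
  weight-linear (var f) f↑ refl ω μ = begin
    arrowWeight (ty f) ((ω [ f ≔ μ ]) f)       ≡⟨ weight-at μ ⟩
    μ                                          ≈⟨ *-identityʳ μ ⟨
    μ * 1#                                     ≡⟨ ≡.cong (μ *_) (weight-at 1#) ⟨
    μ * arrowWeight (ty f) ((ω [ f ≔ 1# ]) f)  ∎
    where
    weight-at : ∀ k → arrowWeight (ty f) ((ω [ f ≔ k ]) f) ≡ k
    weight-at k = ≡.trans (arrowWeight-arrow (ty f) f↑) (update-≡ ω f k)
  weight-linear (cst _ _ _ _ pp) f↑ i = ⊥-elim (pos-not-arrow (pp _ i) f↑)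
  weight-linear (cst0 _ _) f↑ ()
  weight-linear (app _ _ pp) f↑ (inj₂ i) = ⊥-elim (pos-not-arrow (pp _ i) f↑)
  weight-linear (app _ _ _) {f} f↑ (inj₁ refl) ω μ = begin
    (ω [ f ≔ μ ]) f       ≡⟨ update-≡ ω f μ ⟩
    μ                     ≈⟨ *-identityʳ μ ⟨
    μ * 1#                ≡⟨ ≡.cong (μ *_) (update-≡ ω f 1#) ⟨
    μ * (ω [ f ≔ 1# ]) f  ∎
  weight-linear (pair d _ d′ dis) {f} f↑ (inj₁ i) ω μ =
    trans (*-cong (weight-linear d f↑ i ω μ) (reflexive (weight-update-∉ d′ f∉ ω μ 1#)))
          (*-assoc μ _ _)
    where f∉ = λ j → dis f (f↑ , i) (f↑ , j)
  weight-linear (pair d _ d′ dis) {f} f↑ (inj₂ i) ω μ =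
    trans (*-cong (reflexive (weight-update-∉ d f∉ ω μ 1#)) (weight-linear d′ f↑ i ω μ))
          (x∙yz≈y∙xz _ μ _)
    where f∉ = λ j → dis f (f↑ , j) (f↑ , i)
  weight-linear (lam _ _ d) f↑ (_ , i) = weight-linear d f↑ i
  weight-linear (lett {p = p} dp d d′ dis _) {f} f↑ (inj₁ i) ω μ =
    trans (*-cong (weight-linear d f↑ i ω μ) (reflexive body-irrelevant)) (*-assoc μ _ _)
    where
    body-irrelevant : weight d′ ((ω [ f ≔ μ ]) [ p ≔1]) ≡ weight d′ ((ω [ f ≔ 1# ]) [ p ≔1])
    body-irrelevant = weight-cong d′ (λ w (_ , j) → assign-agree _ _ dp _ w (λ _ →
      ≡.trans (update-≢ ω μ (λ { refl → dis f (f↑ , i) (f↑ , j) }))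
              (≡.sym (update-≢ ω 1# (λ { refl → dis f (f↑ , i) (f↑ , j) })))))
  weight-linear (lett {p = p} dp d d′ dis _) {f} f↑ (inj₂ (f∉ , i)) ω μ = begin
    weight d (ω [ f ≔ μ ]) * weight d′ ((ω [ f ≔ μ ]) [ p ≔1])
      ≡⟨ ≡.cong₂ _*_ (weight-update-∉ d f∉e ω μ 1#) (weight-assign-comm d′ dp f∉ ω μ) ⟩
    weight d (ω [ f ≔ 1# ]) * weight d′ ((ω [ p ≔1]) [ f ≔ μ ])
      ≈⟨ *-congˡ (weight-linear d′ f↑ i (ω [ p ≔1]) μ) ⟩
    weight d (ω [ f ≔ 1# ]) * (μ * weight d′ ((ω [ p ≔1]) [ f ≔ 1# ]))
      ≈⟨ x∙yz≈y∙xz _ μ _ ⟩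
    μ * (weight d (ω [ f ≔ 1# ]) * weight d′ ((ω [ p ≔1]) [ f ≔ 1# ]))
      ≡⟨ ≡.cong (λ k → μ * (weight d (ω [ f ≔ 1# ]) * k)) (weight-assign-comm d′ dp f∉ ω 1#) ⟨
    μ * (weight d (ω [ f ≔ 1# ]) * weight d′ ((ω [ f ≔ 1# ]) [ p ≔1])) ∎
    where f∉e = λ j → dis f (f↑ , j) (f↑ , i)

  EnvHasMass : Expr → VecEnv → (Var → K) → Set (c ⊔ ℓ)
  EnvHasMass e Φ ω = ∀ w → FV w e → HasMass (ty w) (arrowWeight (ty w) (ω w)) (Φ w)

  arrowWeight-pos : ∀ {T} k → IsPos T → arrowWeight T k ≡ 1#
  arrowWeight-pos _ bool    = refl
  arrowWeight-pos _ (_ ⊗ _) = refl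

  arrowWeight-unit : ∀ T {k} → k ≡ 1# → arrowWeight T k ≡ 1#
  arrowWeight-unit bool    _    = refl
  arrowWeight-unit (_ ⊗ _) _    = refl
  arrowWeight-unit (_ ⊸ _) k≡1 = k≡1

  ≔δ-mass : ∀ {q A} (dq : q ⦂ₚ A) → PosPat q → ∀ c (Φ : VecEnv) (ω ω′ : Var → K) w →
    (¬ w ∈ₚ q → ω′ w ≡ ω w) → (¬ w ∈ₚ q → HasMass (ty w) (arrowWeight (ty w) (ω w)) (Φ w)) →
    HasMass (ty w) (arrowWeight (ty w) (ω′ w)) ((Φ [ dq ≔δ c ]) w)
  ≔δ-mass {q} dq pq c Φ ω ω′ w ω′≡ω outside with w ∈? q
  ... | yes i  = ≡.subst₂ (HasMass (ty w)) (≡.sym (arrowWeight-pos (ω′ w) (pq w i)))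
                          (≡.sym (assign-∈ Φ dq _ i)) (δ-HasMass (pq w i) (component dq c i))
  ... | no  w∉ = ≡.subst₂ (HasMass (ty w)) (≡.cong (arrowWeight (ty w)) (≡.sym (ω′≡ω w∉)))
                          (≡.sym (assign-∉ Φ q _ w∉)) (outside w∉)

  ∑-⟦⟧ₚ : ∀ {p A} (dp : p ⦂ₚ A) → PosPat p → ∀ (Φ : VecEnv) (ω : Var → K) →
          (∀ w → w ∈ₚ p → HasMass (ty w) (arrowWeight (ty w) (ω w)) (Φ w)) → Σw A (⟦ dp ⟧ₚ Φ) ≈ 1#
  ∑-⟦⟧ₚ (pvar v) pp Φ ω env =
    trans (HasMass⇒∑ (pp v refl) (env v refl)) (reflexive (arrowWeight-pos (ω v) (pp v refl)))
  ∑-⟦⟧ₚ {A = A ⊗ B} (ppair dp dq _) pp Φ ω env = begin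
    Σw (A ⊗ B) (λ (a₁ , a₂) → ⟦ dp ⟧ₚ Φ a₁ * ⟦ dq ⟧ₚ Φ a₂)
      ≈⟨ ∑-cartesianProduct-* (enum A) (enum B) (⟦ dp ⟧ₚ Φ) (⟦ dq ⟧ₚ Φ) ⟩
    Σw A (⟦ dp ⟧ₚ Φ) * Σw B (⟦ dq ⟧ₚ Φ)
      ≈⟨ *-cong (∑-⟦⟧ₚ dp (λ w i → pp w (inj₁ i)) Φ ω (λ w i → env w (inj₁ i)))
                (∑-⟦⟧ₚ dq (λ w i → pp w (inj₂ i)) Φ ω (λ w i → env w (inj₂ i))) ⟩
    1# * 1#
      ≈⟨ *-identityˡ 1# ⟩
    1# ∎

  curried-mass : ∀ {A P T k φ} (A≡ : A ≡ P ⊸ T) → HasMass A (arrowWeight A k) φ →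
                 ∀ a → HasMass T k (curried A≡ φ a)
  curried-mass refl (mass-⊸ rows) = rows

  PosPat⇒IsPos : ∀ {p A} → p ⦂ₚ A → PosPat p → IsPos A
  PosPat⇒IsPos (pvar v)        pp = pp v refl
  PosPat⇒IsPos (ppair dp dq _) pp =
    PosPat⇒IsPos dp (λ w → pp w ∘ inj₁) ⊗ PosPat⇒IsPos dq (λ w → pp w ∘ inj₂)

  IsPos⇒PosPat : ∀ {p A} → p ⦂ₚ A → IsPos A → PosPat p
  IsPos⇒PosPat (pvar v)        pA        .v refl     = pA
  IsPos⇒PosPat (ppair dp dq _) (pA ⊗ pB) w  (inj₁ i) = IsPos⇒PosPat dp pA w i
  IsPos⇒PosPat (ppair dp dq _) (pA ⊗ pB) w  (inj₂ i) = IsPos⇒PosPat dq pB w i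

  IsLet-⊗ : ∀ {A B} → IsLet (A ⊗ B) → IsPos A × IsLet B
  IsLet-⊗ (pos (pA ⊗ pB)) = pA , pos pB
  IsLet-⊗ (ten pA lB)     = pA , lB

  IsArrow⇒shape : ∀ {T} → IsArrow T → IsArrowShape T
  IsArrow⇒shape (arr _ _) = tt

  module _ (varTy : ∀ v → IsVarTy (ty v)) where

    IsVarTy⇒IsLet : ∀ {A} → IsVarTy A → IsLet A
    IsVarTy⇒IsLet (inj₁ pA)         = pos pA
    IsVarTy⇒IsLet (inj₂ (arr pP lT)) = arr pP lT

    ⦂⇒IsLet : ∀ {e T} → e ⦂ T → IsLet T
    ⦂⇒IsLet (var v)              = IsVarTy⇒IsLet (varTy v)
    ⦂⇒IsLet (cst _ pQ _ _ _)     = pos pQ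
    ⦂⇒IsLet (cst0 pQ _)          = pos pQ
    ⦂⇒IsLet (app {f = f} f⦂ _ _) = codomain (varTy f) f⦂
      where
      codomain : ∀ {A P T} → IsVarTy A → A ≡ P ⊸ T → IsLet T
      codomain (inj₁ ())            refl
      codomain (inj₂ (arr _ lT)) refl = lT
    ⦂⇒IsLet (pair _ pP d′ _)     = ten pP (⦂⇒IsLet d′)
    ⦂⇒IsLet (lam dp pp d)        = arr (PosPat⇒IsPos dp pp) (⦂⇒IsLet d)
    ⦂⇒IsLet (lett _ _ d′ _ _)    = ⦂⇒IsLet d′

    let-mass : ∀ {e₂ U} (d₂ : e₂ ⦂ U) →
      (∀ Φ ω → EnvHasMass e₂ Φ ω → HasMass U (weight d₂ ω) (⟦ d₂ ⟧ᵥ Φ)) →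
      ∀ {q T} (dq : q ⦂ₚ T) → IsLet T → ∀ Φ ω {m t} → HasMass T m t →
      (∀ w → FV w e₂ → ¬ w ∈ₚ q → HasMass (ty w) (arrowWeight (ty w) (ω w)) (Φ w)) →
      (∀ w → w ∈ₚ q → IsArrowShape (ty w) → FV w e₂) →
      HasMass U (m * weight d₂ (ω [ q ≔1])) (λ b → Σw T (λ c → t c * ⟦ d₂ ⟧ᵥ (Φ [ dq ≔δ c ]) b))
    let-mass {e₂} d₂ mass₂ (pvar v) _ Φ ω {m} {t} t-mass outside bound-used with varTy v
    ... | inj₁ pv = HasMass-resp (*-congʳ (HasMass⇒∑ pv t-mass)) (λ _ → ≈-refl)
      (HasMass-mix (enum (ty v)) t (λ c → mass₂ _ _ (λ w i →
        ≔δ-mass (pvar v) (λ { _ refl → pv }) c Φ ω (ω [ pvar v ≔1]) w (assign-∉ ω (pvar v) (λ _ → 1#))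
                (outside w i))))
    ... | inj₂ av = HasMass-resp (weight-linear d₂ v↑ v-used ω m)
                                 (λ b → sym (⟦⟧ᵥ-linear d₂ v↑ v-used Φ b t))
                                 (mass₂ (Φ [ v ≔ t ]) (ω [ v ≔ m ]) env)
      where
      v↑ = IsArrow⇒shape av
      v-used = bound-used v refl v↑
      env : EnvHasMass e₂ (Φ [ v ≔ t ]) (ω [ v ≔ m ])
      env w i = env-at w i (w ≟ v)
        where
        env-at : ∀ w → FV w e₂ → Dec (w ≡ v) →
                 HasMass (ty w) (arrowWeight (ty w) ((ω [ v ≔ m ]) w)) ((Φ [ v ≔ t ]) w)
        env-at .v _ (yes refl) = ≡.subst₂ (HasMass (ty v))
          (≡.sym (≡.trans (≡.cong (arrowWeight (ty v)) (update-≡ ω v m)) (arrowWeight-arrow (ty v) v↑)))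
          (≡.sym (update-≡ Φ v t)) t-mass
        env-at w i (no w≢v) = ≡.subst₂ (HasMass (ty w))
          (≡.cong (arrowWeight (ty w)) (≡.sym (update-≢ ω m w≢v)))
          (≡.sym (update-≢ Φ t w≢v)) (outside w i w≢v)
    let-mass d₂ mass₂ {T = A ⊗ B} (ppair {q₁} {q₂} dq₁ dq₂ _) lT Φ ω {m} (mass-⊗ μ μ-sum slices)
             outside bound-used =
      HasMass-resp (trans (sym (*-distribʳ-∑ _ (enum A) μ)) (*-congʳ μ-sum))
                   (λ b → sym (∑-cartesianProduct (enum A) (enum B) _))
        (HasMass-∑ (enum A) (λ a →
          let-mass d₂ mass₂ dq₂ lB (Φ [ dq₁ ≔δ a ]) (ω [ q₁ ≔1]) (slices a)
            (λ w i w∉₂ → ≔δ-mass dq₁ (IsPos⇒PosPat dq₁ pA) a Φ ω (ω [ q₁ ≔1]) w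
                           (assign-∉ ω q₁ (λ _ → 1#)) (λ w∉₁ → outside w i [ w∉₁ , w∉₂ ]))
            (λ w j → bound-used w (inj₂ j))))
      where
      pA = proj₁ (IsLet-⊗ lT)
      lB = proj₂ (IsLet-⊗ lT)

    ⟦⟧ᵥ-mass : ∀ {e T} (d : e ⦂ T) Φ ω → EnvHasMass e Φ ω → HasMass T (weight d ω) (⟦ d ⟧ᵥ Φ)
    ⟦⟧ᵥ-mass (var v) Φ ω env = env v refl
    ⟦⟧ᵥ-mass (cst {P = P} _ pQ M-stoch dp pp) Φ ω env =
      HasMass-resp (trans (*-identityʳ _) (∑-⟦⟧ₚ dp pp Φ ω env)) (λ _ → ≈-refl)
        (HasMass-mix (enum P) (⟦ dp ⟧ₚ Φ) (λ a → ∑⇒HasMass pQ (M-stoch a)))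
    ⟦⟧ᵥ-mass (cst0 pQ m-prob) Φ ω env = ∑⇒HasMass pQ m-prob
    ⟦⟧ᵥ-mass (app {f = f} {P = P} f⦂ dp pp) Φ ω env =
      HasMass-resp (trans (*-congʳ (∑-⟦⟧ₚ dp pp Φ ω (λ w i → env w (inj₂ i)))) (*-identityˡ (ω f)))
                   (λ _ → ≈-refl)
        (HasMass-mix (enum P) (⟦ dp ⟧ₚ Φ) (curried-mass f⦂ (env f (inj₁ refl))))
    ⟦⟧ᵥ-mass (pair {P = P} d pP d′ _) Φ ω env =
      mass-⊗ (λ a → ⟦ d ⟧ᵥ Φ a * weight d′ ω)
             (trans (sym (*-distribʳ-∑ _ (enum P) _))
                    (*-congʳ (HasMass⇒∑ pP (⟦⟧ᵥ-mass d Φ ω (λ w i → env w (inj₁ i))))))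
             (λ a → HasMass-* (⟦ d ⟧ᵥ Φ a) (⟦⟧ᵥ-mass d′ Φ ω (λ w i → env w (inj₂ i))))
    ⟦⟧ᵥ-mass (lam dp pp d) Φ ω env = mass-⊸ (λ a → ⟦⟧ᵥ-mass d (Φ [ dp ≔δ a ]) ω (λ w i →
      ≔δ-mass dp pp a Φ ω ω w (λ _ → refl) (λ w∉ → env w (w∉ , i))))
    ⟦⟧ᵥ-mass (lett dp d d′ _ bound-used) Φ ω env =
      let-mass d′ (⟦⟧ᵥ-mass d′) dp (⦂⇒IsLet d) Φ ω (⟦⟧ᵥ-mass d Φ ω (λ w i → env w (inj₁ i)))
               (λ w i w∉ → env w (inj₂ (w∉ , i))) (λ w j w↑ → proj₂ (bound-used w j w↑))

  weight-unit : ∀ {e T} (d : e ⦂ T) {ω : Var → K} → (∀ w → ω w ≡ 1#) → weight d ω ≈ 1#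
  weight-unit (var v)             ω≡1 = reflexive (arrowWeight-unit (ty v) (ω≡1 v))
  weight-unit (cst _ _ _ _ _)     ω≡1 = ≈-refl
  weight-unit (cst0 _ _)          ω≡1 = ≈-refl
  weight-unit (app {f = f} _ _ _) ω≡1 = reflexive (ω≡1 f)
  weight-unit (pair d _ d′ _)     ω≡1 =
    trans (*-cong (weight-unit d ω≡1) (weight-unit d′ ω≡1)) (*-identityˡ 1#)
  weight-unit (lam _ _ d)         ω≡1 = weight-unit d ω≡1
  weight-unit (lett {p = p} dp d d′ _ _) {ω} ω≡1 =
    trans (*-cong (weight-unit d ω≡1) (weight-unit d′ reset≡1)) (*-identityˡ 1#)
    where
    reset≡1 : ∀ w → (ω [ p ≔1]) w ≡ 1#
    reset≡1 w with w ∈? p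
    ... | yes i  = assign-∈ ω dp _ i
    ... | no  w∉ = ≡.trans (assign-∉ ω p _ w∉) (ω≡1 w)

  ≔δ-upd : ∀ {p A} (dp : p ⦂ₚ A) c {Φ : VecEnv} {ρ : Env} → (∀ w → Φ w ≗ δ (ty w) (ρ w)) →
           ∀ w → (Φ [ dp ≔δ c ]) w ≗ δ (ty w) (upd dp c ρ w)
  ≔δ-upd (pvar v) c Φ≗ w x with w ≟ v
  ... | yes refl = refl
  ... | no  _    = Φ≗ w x
  ≔δ-upd (ppair dp dq _) (c₁ , c₂) Φ≗ = ≔δ-upd dq c₂ (≔δ-upd dp c₁ Φ≗)

  ⟦⟧ₚ-δ : ∀ {p A} (dp : p ⦂ₚ A) {Φ : VecEnv} {ρ : Env} → (∀ w → Φ w ≗ δ (ty w) (ρ w)) →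
          ∀ a → ⟦ dp ⟧ₚ Φ a ≈ δ A (readP dp ρ) a
  ⟦⟧ₚ-δ (pvar v) Φ≗ a = reflexive (Φ≗ v a)
  ⟦⟧ₚ-δ {A = A ⊗ B} (ppair dp dq _) Φ≗ (a₁ , a₂) =
    trans (*-cong (⟦⟧ₚ-δ dp Φ≗ a₁) (⟦⟧ₚ-δ dq Φ≗ a₂)) (sym (δ-⊗ A B _ _ a₁ a₂))

  curried-δ : ∀ {A P T} (A≡ : A ≡ P ⊸ T) {φ x} → φ ≗ δ A x → ∀ a b →
              curried A≡ φ a b ≈ δ P (proj₁ (≡.subst web A≡ x)) a * δ T (proj₂ (≡.subst web A≡ x)) b
  curried-δ {P = P} {T} refl {x = x} φ≗ a b =
    trans (reflexive (φ≗ (a , b))) (δ-⊸ P T (proj₁ x) (proj₂ x) a b)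

  ⟦⟧≈⟦⟧ᵥ : ∀ {e T} (d : e ⦂ T) ρ {Φ : VecEnv} → (∀ w → Φ w ≗ δ (ty w) (ρ w)) →
           ∀ b → ⟦ d ⟧ ρ b ≈ ⟦ d ⟧ᵥ Φ b
  ⟦⟧≈⟦⟧ᵥ (var v) ρ Φ≗ b = reflexive (≡.sym (Φ≗ v b))
  ⟦⟧≈⟦⟧ᵥ (cst {P = P} {M = M} _ _ _ dp _) ρ Φ≗ b =
    sym (trans (∑-cong (enum P) (λ a → *-congʳ (⟦⟧ₚ-δ dp Φ≗ a))) (∑-δ P (readP dp ρ) (λ a → M a b)))
  ⟦⟧≈⟦⟧ᵥ (cst0 _ _) ρ Φ≗ b = ≈-refl
  ⟦⟧≈⟦⟧ᵥ (app {f = f} {P = P} {T = T} f⦂ dp _) ρ {Φ} Φ≗ b = sym (begin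
    Σw P (λ a → ⟦ dp ⟧ₚ Φ a * curried f⦂ (Φ f) a b)
      ≈⟨ ∑-cong (enum P) (λ a → *-cong (⟦⟧ₚ-δ dp Φ≗ a) (curried-δ f⦂ (Φ≗ f) a b)) ⟩
    Σw P (λ a → δ P (readP dp ρ) a * (δ P (proj₁ ρf) a * δ T (proj₂ ρf) b))
      ≈⟨ ∑-δ P (readP dp ρ) _ ⟩
    δ P (proj₁ ρf) (readP dp ρ) * δ T (proj₂ ρf) b ∎)
    where ρf = ≡.subst web f⦂ (ρ f)
  ⟦⟧≈⟦⟧ᵥ (pair d _ d′ _) ρ Φ≗ (b , b′) = *-cong (⟦⟧≈⟦⟧ᵥ d ρ Φ≗ b) (⟦⟧≈⟦⟧ᵥ d′ ρ Φ≗ b′)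
  ⟦⟧≈⟦⟧ᵥ (lam dp _ d) ρ Φ≗ (a , b) = ⟦⟧≈⟦⟧ᵥ d (upd dp a ρ) (≔δ-upd dp a Φ≗) b
  ⟦⟧≈⟦⟧ᵥ (lett {T = T} dp d d′ _ _) ρ Φ≗ b = ∑-cong (enum T) (λ c →
    *-cong (⟦⟧≈⟦⟧ᵥ d ρ Φ≗ c) (⟦⟧≈⟦⟧ᵥ d′ (upd dp c ρ) (≔δ-upd dp c Φ≗) b))

proposition1 : {c ℓ : Level} (R : CommutativeSemiring c ℓ)
    (Var : Set) (_≟_ : DecidableEquality Var) (ty : Var → Ty) →
    (∀ v → IsVarTy (ty v)) →
    let open Calculus R Var _≟_ ty
        open CommutativeSemiring R
    in (e : Expr) (T : Ty) (d : e ⦂ T) → Closed e → (ρ : Env) →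
       Σw T (⟦ d ⟧ ρ) ≈ fromℕ (ht T)
proposition1 R Var _≟_ ty varTy e T d closed ρ = begin
    Σw T (⟦ d ⟧ ρ)             ≈⟨ ∑-cong (enum T) (⟦⟧≈⟦⟧ᵥ d ρ (λ _ _ → refl)) ⟩
    Σw T (⟦ d ⟧ᵥ Φ)            ≈⟨ ∑-HasMass (⟦⟧ᵥ-mass varTy d Φ ω (λ w i → ⊥-elim (closed w i))) ⟩
    fromℕ (ht T) * weight d ω  ≈⟨ *-congˡ (weight-unit d (λ _ → refl)) ⟩
    fromℕ (ht T) * 1#          ≈⟨ *-identityʳ _ ⟩
    fromℕ (ht T)               ∎
  where
  open Calculus R Var _≟_ ty
  open CommutativeSemiring R using (Carrier; _*_; 1#; setoid; *-congˡ; *-identityʳ)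
  open ListSum R using (∑-cong)
  open Mass R Var _≟_ ty
  open import Relation.Binary.Reasoning.Setoid setoid
  Φ : VecEnv
  Φ w = δ (ty w) (ρ w)
  ω : Var → Carrier
  ω _ = 1#
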